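{- For every integer $t\ge 0$, the set of $(t+1)$-reverse pass sortable permutations is a permutation class, i.e. it is closed downward under pattern containment.
   Context: A permutation $\pi\in S_n$ contains $\sigma\in S_k$ if there are indices $\alpha_1<\cdots<\alpha_k$ with $\pi_{\alpha_i}<\pi_{\alpha_j}$ iff $\sigma_i<\sigma_j$. A permutation class is a set of permutations closed under containment. Sorting procedure: a permutation $\pi$ is processed using an input sequence (initially $\pi_1,\ldots,\pi_n$), a stack and an output. Let $m$ be the smallest value not yet output. At each step: if the stack's top entry equals $m$, pop it to the output; otherwise, if the input is nonempty, push the next input entry onto the stack. When no move is possible and the stack is nonempty, the remaining stack entries are returned to the input in the reverse of their order in the previous input (i.e. listed from top of stack to bottom), and the procedure is repeated; each run is a reverse pass. The rev-tier $t_{\operatorname{rev}}(\pi)$ is the number of times entries must be returned to the input before the output is $1,2,\ldots,n$. A permutation is $k$-reverse pass sortable if it is sorted using at most $k$ reverse passes, i.e. $t_{\operatorname{rev}}(\pi)\le k-1$. -}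

module Defs where

open import Data.Nat using (ℕ; zero; suc; _<_; _≟_)
open import Data.Bool using (Bool; true; false; T)
open import Data.List using (List; []; _∷_; length; map; upTo)
open import Data.List.Relation.Binary.Permutation.Propositional using (_↭_)
open import Data.List.Relation.Binary.Sublist.Propositional using (_⊆_)
open import Data.List.Relation.Binary.Pointwise using (Pointwise)
open import Data.Product using (Σ; _×_; _,_)
open import Data.Unit using (⊤)
open import Data.Empty using (⊥)
open import Function.Bundles using (_⇔_)
open import Relation.Nullary using (yes; no)

IsPerm : List ℕ → Set
IsPerm π = π ↭ map suc (upTo (length π))

OrderIso : List ℕ → List ℕ → Set
OrderIso [] [] = ⊤
OrderIso [] (_ ∷ _) = ⊥
OrderIso (_ ∷ _) [] = ⊥
OrderIso (x ∷ xs) (y ∷ ys) =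
  Pointwise (λ x' y' → ((x < x') ⇔ (y < y')) × ((x' < x) ⇔ (y' < y))) xs ys
  × OrderIso xs ys

Contains : List ℕ → List ℕ → Set
Contains π σ = Σ (List ℕ) (λ ys → (ys ⊆ π) × OrderIso σ ys)

IsPermClass : (List ℕ → Set) → Set
IsPermClass C = ∀ π σ → IsPerm π → IsPerm σ → Contains π σ → C π → C σ

-- Arguments: input (head = next entry), stack (head = top),
-- m = smallest value not yet output.
pass : List ℕ → List ℕ → ℕ → ℕ × List ℕ
pass inp (s ∷ st) m with s ≟ m
... | yes _ = pass inp st (suc m)
pass (x ∷ inp) (s ∷ st) m | no _ = pass inp (x ∷ s ∷ st) m
pass [] (s ∷ st) m | no _ = m , s ∷ st
pass (x ∷ inp) [] m = pass inp (x ∷ []) m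
pass [] [] m = m , []

-- After a pass with
-- nonempty remaining stack, the stack entries (top to bottom, i.e. the reverse
-- of their order in the previous input) become the new input.
sortsWithin : ℕ → ℕ → List ℕ → Bool
sortsWithin zero m inp = false
sortsWithin (suc k) m inp with pass inp [] m
... | m' , [] = true
... | m' , (s ∷ st) = sortsWithin k m' (s ∷ st)

-- π is k-reverse pass sortable (t_rev(π) ≤ k - 1); values are 1,…,n so the
-- first value to output is 1.
RevPassSortable : ℕ → List ℕ → Set
RevPassSortable k π = T (sortsWithin k 1 π)

module Submission where

-- Call b a 231-middle of a sequence w if w has a subsequence  b u a  with
-- a < b < u.  For a duplicate-free w whose values form an interval [lo, hi),
-- a pass started with counter lo stops with counter j and leftover stack r
-- such that (1) r lists the entries of w that are at least j, in reverse
-- reading order, (2) j ≤ b for every 231-middle b of w, and (3) if r is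
-- nonempty then j is itself a 231-middle of w.  These facts come from an
-- invariant of the pass (module PassInvariant, summarised by passSpec).
-- If σ is order-isomorphic to a subsequence of π, then by (3) the threshold j′
-- of σ is a 231-middle whose image y in π is a 231-middle, so j ≤ y by (2);
-- hence every entry left over by σ is matched by an entry left over by π, and
-- by (1) the embedding restricts to the leftover stacks (leftover-embedding).
-- Induction on the number of passes shows that if π is sorted within k passes
-- then so is σ (sortsWithin-mono); the main theorem is the case k = t + 1.

open import Defs
open import Data.Nat using (ℕ; zero; suc; _≤_; _<_; _≤?_; _≟_; z≤n; s≤s)
open import Data.Nat.Properties
  using (≤-trans; ≤-refl; ≤∧≢⇒<; ≮⇒≥; <⇒≱; <⇒≤; <-irrefl; n<1+n; n≤1+n; 1+n≰n; suc-injective)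
open import Data.Bool using (T)
open import Data.Unit using (⊤; tt)
open import Data.Empty using (⊥-elim)
open import Data.Sum using (_⊎_; inj₁; inj₂)
import Data.Sum as Sum
open import Data.Product using (∃; ∃₂; _×_; _,_; proj₁; proj₂)
open import Data.List using (List; []; _∷_; _++_; [_]; filter; reverse; map; length; upTo)
open import Data.List.Properties
  using (filter-++; filter-all; filter-accept; filter-reject; unfold-reverse; reverse-involutive;
         reverse-map; ++-assoc; ++-identityʳ)
open import Data.List.Membership.Propositional using (_∈_; _∉_)
open import Data.List.Membership.Propositional.Properties
  using (∈-++⁺ˡ; ∈-++⁺ʳ; ∈-filter⁺; ∈-filter⁻; ∈-map⁺; ∈-map⁻; ∈-upTo⁺; ∈-upTo⁻)
open import Data.List.Relation.Unary.Any using (here; there)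
import Data.List.Relation.Unary.Any.Properties as Any
open import Data.List.Relation.Unary.All using (All; []; _∷_)
import Data.List.Relation.Unary.All as All
open import Data.List.Relation.Unary.AllPairs using ([]; _∷_)
open import Data.List.Relation.Unary.Unique.Propositional using (Unique)
import Data.List.Relation.Unary.Unique.Propositional.Properties as Unique
open import Data.List.Relation.Binary.Pointwise using (Pointwise; []; _∷_)
open import Data.List.Relation.Binary.Permutation.Propositional using (↭⇒↭ₛ; ↭-sym)
open import Data.List.Relation.Binary.Permutation.Propositional.Properties using (↭-reverse; ∈-resp-↭)
import Data.List.Relation.Binary.Permutation.Setoid.Properties as PermutationSetoid
open import Data.List.Relation.Binary.Sublist.Propositional
  using (_⊆_; []; _∷_; _∷ʳ_; ⊆-refl; ⊆-trans; to∈; from∈; lookup)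
import Data.List.Relation.Binary.Sublist.Propositional.Properties as Sublist
open import Function using (_∘_)
open import Function.Bundles using (Equivalence)
open import Relation.Nullary using (¬_; yes; no)
open import Relation.Unary using (Decidable)
open import Relation.Binary.PropositionalEquality
  using (_≡_; _≢_; refl; sym; trans; cong; cong₂; subst; subst₂; setoid; module ≡-Reasoning)

open ≡-Reasoning

last-⊆-++ : ∀ {A : Set} (c : List A) {d} xs {a} → xs ++ [ a ] ⊆ c ++ d → a ∈ d ⊎ xs ++ [ a ] ⊆ c
last-⊆-++ []      xs       sub          = inj₁ (lookup sub (∈-++⁺ʳ xs (here refl)))
last-⊆-++ (y ∷ c) []       (_ ∷ʳ sub)   = Sum.map₂ (y ∷ʳ_) (last-⊆-++ c [] sub)
last-⊆-++ (y ∷ c) []       (refl ∷ sub) = inj₂ (refl ∷ Sublist.[]⊆-universal c)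
last-⊆-++ (y ∷ c) (x ∷ xs) (_ ∷ʳ sub)   = Sum.map₂ (y ∷ʳ_) (last-⊆-++ c (x ∷ xs) sub)
last-⊆-++ (y ∷ c) (x ∷ xs) (refl ∷ sub) = Sum.map₂ (refl ∷_) (last-⊆-++ c xs sub)

unique⇒no-repeat : ∀ {A : Set} {x : A} {ys} → Unique ys → ¬ (x ∷ x ∷ []) ⊆ ys
unique⇒no-repeat []        ()
unique⇒no-repeat (_  ∷ u)  (_ ∷ʳ sub)   = unique⇒no-repeat u sub
unique⇒no-repeat (x∉ ∷ _)  (refl ∷ sub) = All.lookup x∉ (to∈ sub) refl

unique-reverse : ∀ {xs : List ℕ} → Unique xs → Unique (reverse xs)
unique-reverse {xs} = PermutationSetoid.Unique-resp-↭ (setoid ℕ) (↭⇒↭ₛ (↭-sym (↭-reverse xs)))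

⊆-filter : ∀ {A : Set} {P : A → Set} (P? : Decidable P) {xs ys} →
           xs ⊆ ys → All P xs → xs ⊆ filter P? ys
⊆-filter P? xs⊆ys Pxs =
  subst (_⊆ _) (filter-all P? Pxs) (Sublist.filter⁺ P? P? (λ { refl p → p }) xs⊆ys)

filter-filter : ∀ {A : Set} {P Q : A → Set} (P? : Decidable P) (Q? : Decidable Q) →
                (∀ {x} → Q x → P x) → ∀ xs → filter Q? (filter P? xs) ≡ filter Q? xs
filter-filter P? Q? Q⇒P [] = refl
filter-filter P? Q? Q⇒P (x ∷ xs) with P? x
... | yes _ with Q? x
...   | yes _ = cong (x ∷_) (filter-filter P? Q? Q⇒P xs)
...   | no _  = filter-filter P? Q? Q⇒P xs
filter-filter P? Q? Q⇒P (x ∷ xs) | no ¬p with Q? x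
...   | yes q = ⊥-elim (¬p (Q⇒P q))
...   | no _  = filter-filter P? Q? Q⇒P xs

map-filter : ∀ {A B : Set} {P : B → Set} (P? : Decidable P) (f : A → B) xs →
             map f (filter (P? ∘ f) xs) ≡ filter P? (map f xs)
map-filter P? f [] = refl
map-filter P? f (x ∷ xs) with P? (f x)
... | yes _ = cong (f x ∷_) (map-filter P? f xs)
... | no _  = map-filter P? f xs

⊆-map⁻ : ∀ {A B : Set} (f : A → B) {ys} xs → ys ⊆ map f xs → ∃ λ zs → zs ⊆ xs × map f zs ≡ ys
⊆-map⁻ f []       []           = [] , [] , refl
⊆-map⁻ f (x ∷ xs) (_ ∷ʳ sub)   with ⊆-map⁻ f xs sub
... | zs , zs⊆xs , refl = zs , x ∷ʳ zs⊆xs , refl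
⊆-map⁻ f (x ∷ xs) (refl ∷ sub) with ⊆-map⁻ f xs sub
... | zs , zs⊆xs , refl = x ∷ zs , refl ∷ zs⊆xs , refl

Middle231 : List ℕ → ℕ → Set
Middle231 w b = ∃₂ λ u a → (b ∷ u ∷ a ∷ []) ⊆ w × a < b × b < u

record PassSpec (w : List ℕ) (m₀ j : ℕ) (r : List ℕ) : Set where
  field
    leftover≡ : r ≡ reverse (filter (j ≤?_) w)
    below231  : ∀ {b} → Middle231 w b → j ≤ b
    stuck     : j ∈ r → Middle231 w j
    start≤    : m₀ ≤ j

module PassInvariant (w : List ℕ) (uniq : Unique w) (m₀ : ℕ) where

  Buried : List ℕ → ℕ → Set
  Buried []       m = ⊤
  Buried (t ∷ st) m = t ≢ m → m ∈ st → Middle231 w m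

  under-top : ∀ {s st m} → s ≢ m → Buried (s ∷ st) m → m ∈ s ∷ st → Middle231 w m
  under-top s≢m _      (here m≡s)   = ⊥-elim (s≢m (sym m≡s))
  under-top s≢m buried (there m∈st) = buried s≢m m∈st

  record Invariant (inp st : List ℕ) (m : ℕ) (c : List ℕ) : Set where
    field
      read++unread : c ++ inp ≡ w
      stack≡       : reverse st ≡ filter (m ≤?_) c
      unread≥      : All (m ≤_) inp
      buried       : Buried st m
      below231     : ∀ {b} → Middle231 w b → m ≤ b
      start≤       : m₀ ≤ m

    read⊆w : c ⊆ w
    read⊆w = subst (c ⊆_) read++unread (Sublist.++⁺ʳ inp ⊆-refl)

  initial : All (m₀ ≤_) w → Invariant w [] m₀ []
  initial w≥m₀ = record
    { read++unread = refl
    ; stack≡       = refl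
    ; unread≥      = w≥m₀
    ; buried       = tt
    ; below231     = λ (_ , _ , b∈w , _) → All.lookup w≥m₀ (to∈ b∈w)
    ; start≤       = ≤-refl
    }

  module Pop {inp st m c} (I : Invariant inp (m ∷ st) m c) where
    open Invariant I

    stack++m≡ : reverse st ++ [ m ] ≡ filter (m ≤?_) c
    stack++m≡ = trans (sym (unfold-reverse m st)) stack≡

    stack++m⊆w : reverse st ++ [ m ] ⊆ w
    stack++m⊆w = subst (_⊆ w) (sym stack++m≡) (⊆-trans (Sublist.filter-⊆ (m ≤?_) c) read⊆w)

    -- m occurs only once in w, so not below the top.
    m∉stack : m ∉ reverse st
    m∉stack m∈ = unique⇒no-repeat uniq (⊆-trans (Sublist.++⁺ (from∈ m∈) ⊆-refl) stack++m⊆w)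

    stack>m : ∀ {x} → x ∈ reverse st → m < x
    stack>m {x} x∈ = ≤∧≢⇒< (proj₂ (∈-filter⁻ (m ≤?_) {xs = c} (subst (x ∈_) stack++m≡ (∈-++⁺ˡ x∈))))
                           (λ { refl → m∉stack x∈ })

    m-read : m ∈ c
    m-read = proj₁ (∈-filter⁻ (m ≤?_) (subst (m ∈_) stack++m≡ (∈-++⁺ʳ (reverse st) (here refl))))

    -- m has been read, so it is no longer among the unread entries.
    unread>m : All (m <_) inp
    unread>m = All.tabulate λ x∈ → ≤∧≢⇒< (All.lookup unread≥ x∈) λ { refl →
      unique⇒no-repeat uniq (subst (_ ⊆_) read++unread (Sublist.++⁺ (from∈ m-read) (from∈ x∈))) }

    stack≡′ : reverse st ≡ filter (suc m ≤?_) c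
    stack≡′ = sym (begin
      filter (suc m ≤?_) c                                         ≡⟨ filter-filter (m ≤?_) (suc m ≤?_) <⇒≤ c ⟨
      filter (suc m ≤?_) (filter (m ≤?_) c)                        ≡⟨ cong (filter (suc m ≤?_)) stack++m≡ ⟨
      filter (suc m ≤?_) (reverse st ++ [ m ])                     ≡⟨ filter-++ (suc m ≤?_) (reverse st) [ m ] ⟩
      filter (suc m ≤?_) (reverse st) ++ filter (suc m ≤?_) [ m ]  ≡⟨ cong₂ _++_ (filter-all (suc m ≤?_) (All.tabulate stack>m))
                                                                                  (filter-reject (suc m ≤?_) 1+n≰n) ⟩
      reverse st ++ []                                             ≡⟨ ++-identityʳ (reverse st) ⟩
      reverse st                                                   ∎)

    -- The popped value is no 231-middle: its '1' would already be read, and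
    -- then its '3', read after m and larger, would sit above m on the stack.
    not-middle : ¬ Middle231 w m
    not-middle (u , a , mua⊆w , a<m , m<u)
      with last-⊆-++ c (m ∷ u ∷ []) (subst (_ ⊆_) (sym read++unread) mua⊆w)
    ... | inj₁ a-unread = <⇒≱ a<m (All.lookup unread≥ a-unread)
    ... | inj₂ mua⊆c
      with last-⊆-++ (reverse st) (m ∷ []) (subst (_ ⊆_) (sym stack++m≡)
             (⊆-filter (m ≤?_) (⊆-trans (refl ∷ refl ∷ a ∷ʳ []) mua⊆c) (≤-refl ∷ <⇒≤ m<u ∷ [])))
    ...   | inj₁ (here u≡m) = <-irrefl (sym u≡m) m<u
    ...   | inj₂ mu⊆stack   = m∉stack (to∈ mu⊆stack)

  -- After popping m, every remaining entry exceeds m; a value m+1 buried under a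
  -- larger top t then forms the 231-occurrence  m+1 t m.
  buried-after-pop : ∀ {m} st → (∀ {x} → x ∈ reverse st → m < x) → reverse st ++ [ m ] ⊆ w →
                     Buried st (suc m)
  buried-after-pop []                 _     _       = tt
  buried-after-pop {m} (t ∷ st) above stack⊆w t≢ sm∈ =
    t , m , ⊆-trans layout⊆ stack⊆w , n<1+n m , ≤∧≢⇒< (above (Any.reverse⁺ {xs = t ∷ st} (here refl))) (t≢ ∘ sym)
    where
    layout : reverse (t ∷ st) ++ [ m ] ≡ reverse st ++ (t ∷ m ∷ [])
    layout = trans (cong (_++ [ m ]) (unfold-reverse t st)) (++-assoc (reverse st) [ t ] [ m ])
    layout⊆ : (suc m ∷ t ∷ m ∷ []) ⊆ reverse (t ∷ st) ++ [ m ]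
    layout⊆ = subst (_ ⊆_) (sym layout) (Sublist.++⁺ (from∈ (Any.reverse⁺ sm∈)) ⊆-refl)

  pop : ∀ {inp st m c} → Invariant inp (m ∷ st) m c → Invariant inp st (suc m) c
  pop {st = st} I = record
    { read++unread = read++unread
    ; stack≡       = stack≡′
    ; unread≥      = unread>m
    ; buried       = buried-after-pop st stack>m stack++m⊆w
    ; below231     = λ mid → ≤∧≢⇒< (below231 mid) λ { refl → not-middle mid }
    ; start≤       = ≤-trans start≤ (n≤1+n _)
    }
    where open Invariant I
          open Pop I

  push : ∀ {x inp st m c} → Invariant (x ∷ inp) st m c → Buried (x ∷ st) m →
         Invariant inp (x ∷ st) m (c ++ [ x ])
  push {x} {inp} {st} {m} {c} I buried′ = record
    { read++unread = trans (++-assoc c [ x ] inp) read++unread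
    ; stack≡       = stack≡′
    ; unread≥      = All.tail unread≥
    ; buried       = buried′
    ; below231     = below231
    ; start≤       = start≤
    }
    where
    open Invariant I
    stack≡′ : reverse (x ∷ st) ≡ filter (m ≤?_) (c ++ [ x ])
    stack≡′ = begin
      reverse (x ∷ st)                          ≡⟨ unfold-reverse x st ⟩
      reverse st ++ [ x ]                       ≡⟨ cong (_++ [ x ]) stack≡ ⟩
      filter (m ≤?_) c ++ [ x ]                 ≡⟨ cong (filter (m ≤?_) c ++_) (filter-accept (m ≤?_) (All.head unread≥)) ⟨
      filter (m ≤?_) c ++ filter (m ≤?_) [ x ]  ≡⟨ filter-++ (m ≤?_) c [ x ] ⟨
      filter (m ≤?_) (c ++ [ x ])               ∎

  stopped : ∀ {st m c} → Invariant [] st m c → (m ∈ st → Middle231 w m) → PassSpec w m₀ m st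
  stopped {st} {m} {c} I stuck = record
    { leftover≡ = begin
        st                             ≡⟨ reverse-involutive st ⟨
        reverse (reverse st)           ≡⟨ cong reverse stack≡ ⟩
        reverse (filter (m ≤?_) c)     ≡⟨ cong (reverse ∘ filter (m ≤?_)) (trans (sym (++-identityʳ c)) read++unread) ⟩
        reverse (filter (m ≤?_) w)     ∎
    ; below231  = below231
    ; stuck     = stuck
    ; start≤    = start≤
    }
    where open Invariant I

  spec : ∀ inp st m {c} → Invariant inp st m c → PassSpec w m₀ (proj₁ (pass inp st m)) (proj₂ (pass inp st m))
  spec inp       (s ∷ st) m I with s ≟ m
  ... | yes refl = spec inp st (suc m) (pop I)
  spec (x ∷ inp) (s ∷ st) m I | no s≢m =
    spec inp (x ∷ s ∷ st) m (push I (λ _ → under-top s≢m (Invariant.buried I)))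
  spec []        (s ∷ st) m I | no s≢m = stopped I (under-top s≢m (Invariant.buried I))
  spec (x ∷ inp) []       m I = spec inp (x ∷ []) m (push I (λ _ ()))
  spec []        []       m I = stopped I (λ ())

passSpec : ∀ {w m₀} → Unique w → All (m₀ ≤_) w →
           PassSpec w m₀ (proj₁ (pass w [] m₀)) (proj₂ (pass w [] m₀))
passSpec {w} {m₀} uniq w≥m₀ = spec w [] m₀ (initial w≥m₀)
  where open PassInvariant w uniq m₀

record Interval (lo hi : ℕ) (w : List ℕ) : Set where
  field
    unique  : Unique w
    bounded : ∀ {x} → x ∈ w → lo ≤ x × x < hi
    covers  : ∀ {x} → lo ≤ x → x < hi → x ∈ w

  lower : All (lo ≤_) w
  lower = All.tabulate (proj₁ ∘ bounded)

module Leftover {lo hi w} (I : Interval lo hi w) {j r} (S : PassSpec w lo j r) where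
  open Interval I
  open PassSpec S

  ∈-leftover⁻ : ∀ {x} → x ∈ r → x ∈ w × j ≤ x
  ∈-leftover⁻ x∈r = ∈-filter⁻ (j ≤?_) (Any.reverse⁻ (subst (_ ∈_) leftover≡ x∈r))

  ∈-leftover⁺ : ∀ {x} → x ∈ w → j ≤ x → x ∈ r
  ∈-leftover⁺ x∈w j≤x = subst (_ ∈_) (sym leftover≡) (Any.reverse⁺ (∈-filter⁺ (j ≤?_) x∈w j≤x))

  interval : Interval j hi r
  interval = record
    { unique  = subst Unique (sym leftover≡) (unique-reverse (Unique.filter⁺ (j ≤?_) unique))
    ; bounded = λ x∈r → let (x∈w , j≤x) = ∈-leftover⁻ x∈r in j≤x , proj₂ (bounded x∈w)
    ; covers  = λ j≤x x<hi → ∈-leftover⁺ (covers (≤-trans start≤ j≤x) x<hi) j≤x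
    }

  middle : ∀ {x} → x ∈ r → Middle231 w j
  middle x∈r with Interval.bounded interval x∈r
  ... | j≤x , x<hi = stuck (Interval.covers interval ≤-refl (≤-trans (s≤s j≤x) x<hi))

SameOrder : ℕ × ℕ → ℕ × ℕ → Set
SameOrder p q = (proj₁ p < proj₁ q → proj₂ p < proj₂ q) × (proj₂ p < proj₂ q → proj₁ p < proj₁ q)

Compatible : List (ℕ × ℕ) → Set
Compatible zs = ∀ {p q} → p ∈ zs → q ∈ zs → SameOrder p q

record Embedding (σ π : List ℕ) : Set where
  field
    pairs      : List (ℕ × ℕ)
    left≡      : map proj₁ pairs ≡ σ
    right⊆     : map proj₂ pairs ⊆ π
    compatible : Compatible pairs

Pointwise-∈ : ∀ {R : ℕ → ℕ → Set} zs → Pointwise R (map proj₁ zs) (map proj₂ zs) →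
              ∀ {p} → p ∈ zs → R (proj₁ p) (proj₂ p)
Pointwise-∈ (_ ∷ _)  (r ∷ _)  (here refl) = r
Pointwise-∈ (_ ∷ zs) (_ ∷ rs) (there p∈)  = Pointwise-∈ zs rs p∈

orderIso-pairs : ∀ σ ys → OrderIso σ ys →
                 ∃ λ zs → map proj₁ zs ≡ σ × map proj₂ zs ≡ ys × Compatible zs
orderIso-pairs []       []       _           = [] , refl , refl , λ ()
orderIso-pairs (x ∷ xs) (y ∷ ys) (rel , iso) with orderIso-pairs xs ys iso
... | zs , refl , refl , compat = (x , y) ∷ zs , refl , refl , compat′
  where
  compat′ : Compatible ((x , y) ∷ zs)
  compat′ (here refl) (here refl) = (λ x<x → ⊥-elim (<-irrefl refl x<x)) , (λ y<y → ⊥-elim (<-irrefl refl y<y))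
  compat′ (here refl) (there q∈)  = let (after , _) = Pointwise-∈ zs rel q∈ in Equivalence.to after , Equivalence.from after
  compat′ (there p∈)  (here refl) = let (_ , before) = Pointwise-∈ zs rel p∈ in Equivalence.to before , Equivalence.from before
  compat′ (there p∈)  (there q∈)  = compat p∈ q∈

contains⇒embedding : ∀ {π σ} → Contains π σ → Embedding σ π
contains⇒embedding {π} {σ} (ys , ys⊆π , iso) with orderIso-pairs σ ys iso
... | zs , left≡ , right≡ , compat = record
  { pairs = zs ; left≡ = left≡ ; right⊆ = subst (_⊆ π) (sym right≡) ys⊆π ; compatible = compat }

embedding-[] : ∀ {x σ} → ¬ Embedding (x ∷ σ) []
embedding-[] record { pairs = [] ; left≡ = () }
embedding-[] record { pairs = _ ∷ _ ; right⊆ = () }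

middle-transfer : ∀ {σ π b} (E : Embedding σ π) → Middle231 σ b →
                  ∃ λ y → (b , y) ∈ Embedding.pairs E × Middle231 π y
middle-transfer {b = b} E (_ , _ , bua⊆σ , a<b , b<u)
  with ⊆-map⁻ proj₁ (Embedding.pairs E) (subst (_ ⊆_) (sym (Embedding.left≡ E)) bua⊆σ)
... | (_ , y) ∷ (_ , v) ∷ (_ , z) ∷ [] , matched , refl =
  y , b↦y , v , z , ⊆-trans (Sublist.map⁺ proj₂ matched) (Embedding.right⊆ E) , z<y , y<v
  where
  b↦y : (b , y) ∈ Embedding.pairs E
  b↦y = lookup matched (here refl)
  z<y : z < y
  z<y = proj₁ (Embedding.compatible E (lookup matched (there (there (here refl)))) b↦y) a<b
  y<v : y < v
  y<v = proj₁ (Embedding.compatible E b↦y (lookup matched (there (here refl)))) b<u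

restrict : ∀ {σ π j′ j} (E : Embedding σ π) →
           (∀ {p} → p ∈ Embedding.pairs E → j′ ≤ proj₁ p → j ≤ proj₂ p) →
           Embedding (reverse (filter (j′ ≤?_) σ)) (reverse (filter (j ≤?_) π))
restrict {σ} {π} {j′} {j} E above = record
  { pairs      = reverse kept
  ; left≡      = begin
      map proj₁ (reverse kept)                     ≡⟨ reverse-map proj₁ kept ⟩
      reverse (map proj₁ kept)                     ≡⟨ cong reverse (map-filter (j′ ≤?_) proj₁ pairs) ⟩
      reverse (filter (j′ ≤?_) (map proj₁ pairs))  ≡⟨ cong (reverse ∘ filter (j′ ≤?_)) left≡ ⟩
      reverse (filter (j′ ≤?_) σ)                  ∎
  ; right⊆     = subst (_⊆ _) (sym (reverse-map proj₂ kept)) (Sublist.reverse⁺ kept⊆)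
  ; compatible = λ p∈ q∈ → compatible (from-kept p∈) (from-kept q∈)
  }
  where
  open Embedding E
  kept : List (ℕ × ℕ)
  kept = filter ((j′ ≤?_) ∘ proj₁) pairs
  from-kept : ∀ {p} → p ∈ reverse kept → p ∈ pairs
  from-kept p∈ = proj₁ (∈-filter⁻ ((j′ ≤?_) ∘ proj₁) (Any.reverse⁻ p∈))
  kept-above : ∀ {y} → y ∈ map proj₂ kept → j ≤ y
  kept-above y∈ with ∈-map⁻ proj₂ y∈
  ... | p , p∈ , refl = let (p∈pairs , j′≤p) = ∈-filter⁻ ((j′ ≤?_) ∘ proj₁) p∈ in above p∈pairs j′≤p
  kept⊆ : map proj₂ kept ⊆ filter (j ≤?_) π
  kept⊆ = ⊆-trans (⊆-filter (j ≤?_) (Sublist.map⁺ proj₂ (Sublist.filter-⊆ _ pairs)) (All.tabulate kept-above))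
                  (Sublist.filter⁺ (j ≤?_) (j ≤?_) (λ { refl j≤y → j≤y }) right⊆)

-- The leftover stack of σ embeds into the leftover stack of π: the threshold j′
-- of σ is a 231-middle matched to a 231-middle y of π, so j ≤ y, and entries of
-- σ at least j′ are matched to entries of π at least y.
leftover-embedding : ∀ {lo′ hi′ σ π lo j′ s r′ j r} → Interval lo′ hi′ σ → Embedding σ π →
                     PassSpec σ lo′ j′ (s ∷ r′) → PassSpec π lo j r → Embedding (s ∷ r′) r
leftover-embedding {j′ = j′} {j = j} Iσ E Sσ Sπ with middle-transfer E (Leftover.middle Iσ Sσ (here refl))
... | y , j′↦y , y-middle =
  subst₂ Embedding (sym (PassSpec.leftover≡ Sσ)) (sym (PassSpec.leftover≡ Sπ)) (restrict E above)
  where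
  above : ∀ {p} → p ∈ Embedding.pairs E → j′ ≤ proj₁ p → j ≤ proj₂ p
  above p∈ j′≤p = ≤-trans (PassSpec.below231 Sπ y-middle)
                          (≮⇒≥ λ p<y → <⇒≱ (proj₂ (Embedding.compatible E p∈ j′↦y) p<y) j′≤p)

sortsWithin-mono : ∀ k {lo′ hi′ σ lo hi π} → Interval lo′ hi′ σ → Interval lo hi π → Embedding σ π →
                   T (sortsWithin k lo π) → T (sortsWithin k lo′ σ)
sortsWithin-mono zero    _  _  _ ()
sortsWithin-mono (suc k) {lo′} {σ = σ} {lo} {π = π} Iσ Iπ E sorted
  with pass π [] lo  | passSpec {π} {lo} (Interval.unique Iπ) (Interval.lower Iπ)
     | pass σ [] lo′ | passSpec {σ} {lo′} (Interval.unique Iσ) (Interval.lower Iσ)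
... | _ , _     | _  | _ , []    | _  = tt
... | _ , []    | Sπ | _ , _ ∷ _ | Sσ = ⊥-elim (embedding-[] (leftover-embedding Iσ E Sσ Sπ))
... | _ , _ ∷ _ | Sπ | _ , _ ∷ _ | Sσ =
  sortsWithin-mono k (Leftover.interval Iσ Sσ) (Leftover.interval Iπ Sπ) (leftover-embedding Iσ E Sσ Sπ) sorted

perm⇒interval : ∀ {π} → IsPerm π → Interval 1 (suc (length π)) π
perm⇒interval {π} π↭ = record
  { unique  = PermutationSetoid.Unique-resp-↭ (setoid ℕ) (↭⇒↭ₛ (↭-sym π↭))
                (Unique.map⁺ suc-injective (Unique.upTo⁺ (length π)))
  ; bounded = λ x∈ → bounds (∈-map⁻ suc (∈-resp-↭ π↭ x∈))
  ; covers  = λ { {zero} () ; {suc i} _ (s≤s i<n) → ∈-resp-↭ (↭-sym π↭) (∈-map⁺ suc (∈-upTo⁺ i<n)) }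
  }
  where
  bounds : ∀ {x} → ∃ (λ i → i ∈ upTo (length π) × x ≡ suc i) → 1 ≤ x × x < suc (length π)
  bounds (i , i∈ , refl) = s≤s z≤n , s≤s (∈-upTo⁻ i∈)

mainTheorem3 : (t : ℕ) → IsPermClass (RevPassSortable (suc t))
mainTheorem3 t π σ π-perm σ-perm π-contains-σ =
  sortsWithin-mono (suc t) (perm⇒interval σ-perm) (perm⇒interval π-perm) (contains⇒embedding π-contains-σ)
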